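{- Let $(c_i)_{i\ge1}$ be a sequence of positive integers and let $F=(F_1,F_2,\dots)$ be the pointwise product of the primary GCD-morphic sequences $G_{c_i,i}$, $i\ge1$; that is, $F_n=\prod_{j\mid n}c_j$ for every $n\ge1$. Then $F$ is GCD-morphic if and only if the following condition holds: $$\text{(C1)}\qquad \text{for all } k,n\ge1:\quad k<n \ \text{ and } \ \gcd(n,k)\neq k \ \Longrightarrow\ \gcd(c_n,c_k)=1.$$
   Context: A sequence $(F_k)_{k\ge1}$ of positive integers is called GCD-morphic if $\gcd(F_k,F_l)=F_{\gcd(k,l)}$ for all $k,l\ge1$. For positive integers $c,N$, the primary GCD-morphic sequence $G_{c,N}=(g_k)_{k\ge1}$ is given by $g_k=c$ if $N\mid k$ and $g_k=1$ otherwise. Products of sequences are taken pointwise. -}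

module Defs where

open import Data.Nat using (ℕ; zero; suc; _*_; _<_; _≥_; NonZero)
open import Data.Nat.Divisibility using (_∣_; _∣?_)
open import Data.Nat.GCD using (gcd)
open import Relation.Nullary.Decidable using (does)
open import Data.Bool using (if_then_else_)
open import Relation.Binary.PropositionalEquality using (_≡_; _≢_)

-- Sequences (F_k)_{k≥1} are modelled as functions ℕ → ℕ; the value at 0 is ignored.

Positive : (ℕ → ℕ) → Set
Positive F = ∀ k → k ≥ 1 → 0 < F k

GCDMorphic : (ℕ → ℕ) → Set
GCDMorphic F = ∀ k l → k ≥ 1 → l ≥ 1 → gcd (F k) (F l) ≡ F (gcd k l)

G : ℕ → ℕ → ℕ → ℕ
G c N k = if does (N ∣? k) then c else 1

prod1 : (ℕ → ℕ) → ℕ → ℕ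
prod1 f zero    = 1
prod1 f (suc m) = prod1 f m * f (suc m)

-- pointwise product of the sequences G_{c_i,i}, i ≥ 1.  For n ≥ 1 the factors
-- with i > n equal 1 (since i ∤ n), so F_n = ∏_{i=1}^{n} G_{c_i,i}(n) = ∏_{j ∣ n} c_j.
ProdPrimary : (ℕ → ℕ) → ℕ → ℕ
ProdPrimary c n = prod1 (λ i → G (c i) i n) n

C1 : (ℕ → ℕ) → Set
C1 c = ∀ k n → k ≥ 1 → n ≥ 1 → k < n → gcd n k ≢ k → gcd (c n) (c k) ≡ 1

module Submission where

-- Let F = ProdPrimary c, so F_n = ∏_{i ≤ n} G_{c_i,i}(n) = ∏_{i ∣ n} c_i.
--
-- For k, l ≥ 1 with g = gcd k l, an index i divides g iff it divides both
-- k and l.  Hence every factor of F_k splits as G_{c_i,i}(k) = G_{c_i,i}(g) · e_i,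
-- where e_i = c_i if i ∣ k and i ∤ l, and e_i = 1 otherwise.  Multiplying
-- out gives the factorisation  F_k = F_g · E(k,l)  with E(k,l) = ∏_{i ∣ k, i ∤ l} c_i,
-- and therefore
--           gcd (F_k, F_l) = F_g · gcd (E(k,l), E(l,k)).
-- Since F_g ≠ 0, F is GCD-morphic iff E(k,l) and E(l,k) are always coprime.
--   (C1) ⇒ morphic: a factor c_i of E(k,l) and a factor c_j of E(l,k) have
--     i ≠ j and neither index divides the other, so (C1) makes them coprime.
--   morphic ⇒ (C1): for k < n with k ∤ n, c_n divides E(n,k) and c_k divides
--     E(k,n), so gcd (c_n, c_k) divides gcd (E(n,k), E(k,n)) = 1.
-- The file first develops finite products prod1 and the 0/1-selection
-- `pick`, then the factorisation, and finally the two directions.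

open import Defs
open import Data.Nat using (ℕ)
open import Data.Product using (_×_)

open import Data.Bool using (Bool; true; false; T; _∧_; not; if_then_else_)
open import Data.Nat using (zero; suc; _*_; _<_; _≤_; _≥_; NonZero; z≤n; s≤s; >-nonZero)
open import Data.Nat.Properties
  using (≤-refl; m≤n⇒m≤1+n; m≤n⇒m<n∨m≡n; *-identityʳ; *-identityˡ; *-cancelˡ-≡; m*n≢0;
         n≢0⇒n>0; m<n⇒n≢0; <-cmp)
open import Data.Nat.Divisibility
  using (_∣_; _∣?_; ∣-refl; ∣-trans; ∣-antisym; ∣⇒≤; >⇒∤; ∣1⇒≡1; m∣m*n; n∣m*n)
open import Data.Nat.GCD
  using (gcd; gcd[m,n]∣m; gcd[m,n]∣n; gcd-greatest; gcd-comm; gcd-zeroʳ; gcd[m,n]≢0;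
         c*gcd[m,n]≡gcd[cm,cn])
open import Data.Nat.Coprimality as Coprime
  using (Coprime; coprime-divisor; coprime⇒gcd≡1; gcd≡1⇒coprime)
open import Data.Nat.Solver using (module +-*-Solver)
open import Data.Product using (_,_; uncurry)
open import Data.Sum using (inj₁; inj₂)
open import Function.Bundles using (mk⇔)
open import Relation.Binary using (tri<; tri≈; tri>)
open import Relation.Binary.PropositionalEquality
  using (_≡_; refl; sym; trans; cong; cong₂; subst; module ≡-Reasoning)
open import Relation.Nullary using (¬_; yes; no; contradiction)
open import Relation.Nullary.Decidable using (does; does-⇔; _×-dec_)

prod1-cong : ∀ {f g : ℕ → ℕ} m → (∀ i → f i ≡ g i) → prod1 f m ≡ prod1 g m
prod1-cong zero    f≡g = refl
prod1-cong (suc m) f≡g = cong₂ _*_ (prod1-cong m f≡g) (f≡g (suc m))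

prod1-* : ∀ (f g : ℕ → ℕ) m → prod1 (λ i → f i * g i) m ≡ prod1 f m * prod1 g m
prod1-* f g zero    = refl
prod1-* f g (suc m) = trans (cong (_* (f (suc m) * g (suc m))) (prod1-* f g m))
  (interchange (prod1 f m) (prod1 g m) (f (suc m)) (g (suc m)))
  where
  open +-*-Solver
  interchange : ∀ a b x y → (a * b) * (x * y) ≡ (a * x) * (b * y)
  interchange = solve 4 (λ a b x y → (a :* b) :* (x :* y) := (a :* x) :* (b :* y)) refl

prod1-extend : ∀ (f : ℕ → ℕ) {m} n → m ≤ n → (∀ i → m < i → i ≤ n → f i ≡ 1) →
               prod1 f n ≡ prod1 f m
prod1-extend f zero    z≤n   trivial = refl
prod1-extend f (suc n) m≤1+n trivial with m≤n⇒m<n∨m≡n m≤1+n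
... | inj₂ refl      = refl
... | inj₁ (s≤s m≤n) = begin
    prod1 f n * f (suc n) ≡⟨ cong (prod1 f n *_) (trivial (suc n) (s≤s m≤n) ≤-refl) ⟩
    prod1 f n * 1         ≡⟨ *-identityʳ (prod1 f n) ⟩
    prod1 f n             ≡⟨ prod1-extend f n m≤n (λ i m<i i≤n → trivial i m<i (m≤n⇒m≤1+n i≤n)) ⟩
    _                     ∎
  where open ≡-Reasoning

prod1-nonZero : ∀ (f : ℕ → ℕ) m → (∀ i → 1 ≤ i → i ≤ m → NonZero (f i)) → NonZero (prod1 f m)
prod1-nonZero f zero    nz = _
prod1-nonZero f (suc m) nz =
  m*n≢0 (prod1 f m) (f (suc m))
    {{prod1-nonZero f m (λ i 1≤i i≤m → nz i 1≤i (m≤n⇒m≤1+n i≤m))}} {{nz (suc m) (s≤s z≤n) ≤-refl}}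

∣-prod1 : ∀ (f : ℕ → ℕ) m {i} → 1 ≤ i → i ≤ m → f i ∣ prod1 f m
∣-prod1 f zero    (s≤s z≤n) ()
∣-prod1 f (suc m) 1≤i i≤1+m with m≤n⇒m<n∨m≡n i≤1+m
... | inj₂ refl      = n∣m*n (prod1 f m)
... | inj₁ (s≤s i≤m) = ∣-trans (∣-prod1 f m 1≤i i≤m) (m∣m*n (f (suc m)))

coprime-* : ∀ {x y z} → Coprime x y → Coprime x z → Coprime x (y * z)
coprime-* {x} {y} cxy cxz (d∣x , d∣yz) = cxz (d∣x , coprime-divisor d⊥y d∣yz)
  where
  d⊥y : Coprime _ y
  d⊥y (e∣d , e∣y) = cxy (∣-trans e∣d d∣x , e∣y)

coprime-1 : ∀ x → Coprime x 1
coprime-1 x = gcd≡1⇒coprime (gcd-zeroʳ x)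

coprime-prod1ʳ : ∀ x (f : ℕ → ℕ) m → (∀ j → 1 ≤ j → j ≤ m → Coprime x (f j)) → Coprime x (prod1 f m)
coprime-prod1ʳ x f zero    cop = coprime-1 x
coprime-prod1ʳ x f (suc m) cop =
  coprime-* (coprime-prod1ʳ x f m (λ j 1≤j j≤m → cop j 1≤j (m≤n⇒m≤1+n j≤m))) (cop (suc m) (s≤s z≤n) ≤-refl)

coprime-prod1 : ∀ (f g : ℕ → ℕ) m n →
                (∀ i j → 1 ≤ i → i ≤ m → 1 ≤ j → j ≤ n → Coprime (f i) (g j)) →
                Coprime (prod1 f m) (prod1 g n)
coprime-prod1 f g m n cop = coprime-prod1ʳ (prod1 f m) g n λ j 1≤j j≤n →
  Coprime.sym (coprime-prod1ʳ (g j) f m λ i 1≤i i≤m → Coprime.sym (cop i j 1≤i i≤m 1≤j j≤n))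

pick : Bool → ℕ → ℕ
pick b x = if b then x else 1

pick-true : ∀ {b} x → T b → pick b x ≡ x
pick-true {true} x _ = refl

pick-nonZero : ∀ b x → NonZero x → NonZero (pick b x)
pick-nonZero true  x nz = nz
pick-nonZero false x nz = _

pick-split : ∀ b₁ b₂ x → pick b₁ x ≡ pick (b₁ ∧ b₂) x * pick (b₁ ∧ not b₂) x
pick-split true  true  x = sym (*-identityʳ x)
pick-split true  false x = sym (*-identityˡ x)
pick-split false b₂    x = refl

coprime-pick : ∀ b₁ b₂ x y → (T b₁ → T b₂ → Coprime x y) → Coprime (pick b₁ x) (pick b₂ y)
coprime-pick true  true  x y cop = cop _ _
coprime-pick true  false x y cop = coprime-1 x
coprime-pick false b₂    x y cop = Coprime.sym (coprime-1 (pick b₂ y))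

does-∣gcd : ∀ i k l → does (i ∣? gcd k l) ≡ does (i ∣? k) ∧ does (i ∣? l)
does-∣gcd i k l =
  does-⇔ (mk⇔ divides-both (uncurry gcd-greatest)) (i ∣? gcd k l) (i ∣? k ×-dec i ∣? l)
  where
  divides-both : i ∣ gcd k l → i ∣ k × i ∣ l
  divides-both i∣g = ∣-trans i∣g (gcd[m,n]∣m k l) , ∣-trans i∣g (gcd[m,n]∣n k l)

divOnly : ℕ → ℕ → ℕ → Bool
divOnly i k l = does (i ∣? k) ∧ not (does (i ∣? l))

divOnly-sound : ∀ i k l → T (divOnly i k l) → i ∣ k × ¬ i ∣ l
divOnly-sound i k l holds with i ∣? k | i ∣? l
... | yes i∣k | no i∤l = i∣k , i∤l

divOnly-complete : ∀ {i k l} → i ∣ k → ¬ i ∣ l → T (divOnly i k l)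
divOnly-complete {i} {k} {l} i∣k i∤l with i ∣? k | i ∣? l
... | yes _ | no _    = _
... | no i∤k | _      = contradiction i∣k i∤k
... | yes _ | yes i∣l = contradiction i∣l i∤l

G-split : ∀ x i k l → G x i k ≡ G x i (gcd k l) * pick (divOnly i k l) x
G-split x i k l = trans (pick-split (does (i ∣? k)) (does (i ∣? l)) x)
  (cong (λ b → pick b x * pick (divOnly i k l) x) (sym (does-∣gcd i k l)))

gcd≡k⇒k∣n : ∀ {n k} → gcd n k ≡ k → k ∣ n
gcd≡k⇒k∣n {n} {k} eq = subst (_∣ n) eq (gcd[m,n]∣m n k)

k∣n⇒gcd≡k : ∀ {n k} → k ∣ n → gcd n k ≡ k
k∣n⇒gcd≡k {n} {k} k∣n = ∣-antisym (gcd[m,n]∣n n k) (gcd-greatest k∣n ∣-refl)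

G-∤ : ∀ x i n → ¬ i ∣ n → G x i n ≡ 1
G-∤ x i n i∤n with i ∣? n
... | yes i∣n = contradiction i∣n i∤n
... | no _    = refl

module _ (c : ℕ → ℕ) where

  -- Excl k l = ∏_{i ∣ k, i ∤ l} c_i, the part of F_k that F_l does not share.
  Excl : ℕ → ℕ → ℕ
  Excl k l = prod1 (λ i → pick (divOnly i k l) (c i)) k

  ProdPrimary-extend : ∀ n m → n ≥ 1 → n ≤ m → prod1 (λ i → G (c i) i n) m ≡ ProdPrimary c n
  ProdPrimary-extend n m n≥1 n≤m = prod1-extend (λ i → G (c i) i n) m n≤m
    λ i n<i _ → G-∤ (c i) i n (>⇒∤ {{>-nonZero n≥1}} n<i)

  ProdPrimary-nonZero : Positive c → ∀ n → NonZero (ProdPrimary c n)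
  ProdPrimary-nonZero pos n = prod1-nonZero (λ i → G (c i) i n) n
    λ i 1≤i _ → pick-nonZero (does (i ∣? n)) (c i) (>-nonZero (pos i 1≤i))

  ProdPrimary-factor : ∀ k l → k ≥ 1 → ProdPrimary c k ≡ ProdPrimary c (gcd k l) * Excl k l
  ProdPrimary-factor k l k≥1 = begin
      ProdPrimary c k
    ≡⟨ prod1-cong k (λ i → G-split (c i) i k l) ⟩
      prod1 (λ i → G (c i) i g * pick (divOnly i k l) (c i)) k
    ≡⟨ prod1-* (λ i → G (c i) i g) (λ i → pick (divOnly i k l) (c i)) k ⟩
      prod1 (λ i → G (c i) i g) k * Excl k l
    ≡⟨ cong (_* Excl k l) (ProdPrimary-extend g k g≥1 g≤k) ⟩
      ProdPrimary c g * Excl k l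
    ∎
    where
    open ≡-Reasoning
    g = gcd k l
    g≤k : g ≤ k
    g≤k = ∣⇒≤ {{>-nonZero k≥1}} (gcd[m,n]∣m k l)
    g≥1 : g ≥ 1
    g≥1 = n≢0⇒n>0 (gcd[m,n]≢0 k l (inj₁ (m<n⇒n≢0 k≥1)))

  gcd-ProdPrimary : ∀ k l → k ≥ 1 → l ≥ 1 →
    gcd (ProdPrimary c k) (ProdPrimary c l) ≡ ProdPrimary c (gcd k l) * gcd (Excl k l) (Excl l k)
  gcd-ProdPrimary k l k≥1 l≥1 = begin
      gcd (ProdPrimary c k) (ProdPrimary c l)
    ≡⟨ cong₂ gcd (ProdPrimary-factor k l k≥1) (ProdPrimary-factor l k l≥1) ⟩
      gcd (ProdPrimary c (gcd k l) * Excl k l) (ProdPrimary c (gcd l k) * Excl l k)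
    ≡⟨ cong (λ g → gcd (ProdPrimary c (gcd k l) * Excl k l) (ProdPrimary c g * Excl l k)) (gcd-comm l k) ⟩
      gcd (ProdPrimary c (gcd k l) * Excl k l) (ProdPrimary c (gcd k l) * Excl l k)
    ≡⟨ sym (c*gcd[m,n]≡gcd[cm,cn] (ProdPrimary c (gcd k l)) (Excl k l) (Excl l k)) ⟩
      ProdPrimary c (gcd k l) * gcd (Excl k l) (Excl l k)
    ∎
    where open ≡-Reasoning

  C1-apart : C1 c → ∀ {i j} → 1 ≤ i → 1 ≤ j → i < j → ¬ i ∣ j → Coprime (c i) (c j)
  C1-apart C1c {i} {j} 1≤i 1≤j i<j i∤j =
    Coprime.sym (gcd≡1⇒coprime (C1c i j 1≤i 1≤j i<j (λ gcd≡i → i∤j (gcd≡k⇒k∣n gcd≡i))))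

  -- Under (C1), a factor exclusive to k is coprime to a factor exclusive to l:
  -- its index is different and neither index divides the other.
  C1-exclusive : C1 c → ∀ {i j k l} → 1 ≤ i → 1 ≤ j → i ∣ k × ¬ i ∣ l → j ∣ l × ¬ j ∣ k →
                 Coprime (c i) (c j)
  C1-exclusive C1c {i} {j} 1≤i 1≤j (i∣k , i∤l) (j∣l , j∤k) with <-cmp i j
  ... | tri< i<j _ _  = C1-apart C1c 1≤i 1≤j i<j (λ i∣j → i∤l (∣-trans i∣j j∣l))
  ... | tri≈ _ refl _ = contradiction i∣k j∤k
  ... | tri> _ _ j<i  = Coprime.sym (C1-apart C1c 1≤j 1≤i j<i (λ j∣i → j∤k (∣-trans j∣i i∣k)))

  C1⇒Excl-coprime : C1 c → ∀ k l → Coprime (Excl k l) (Excl l k)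
  C1⇒Excl-coprime C1c k l = coprime-prod1 _ _ k l λ i j 1≤i _ 1≤j _ →
    coprime-pick (divOnly i k l) (divOnly j l k) (c i) (c j) λ i-only j-only →
      C1-exclusive C1c 1≤i 1≤j (divOnly-sound i k l i-only) (divOnly-sound j l k j-only)

  C1⇒GCDMorphic : C1 c → GCDMorphic (ProdPrimary c)
  C1⇒GCDMorphic C1c k l k≥1 l≥1 = begin
      gcd (ProdPrimary c k) (ProdPrimary c l)    ≡⟨ gcd-ProdPrimary k l k≥1 l≥1 ⟩
      Fg * gcd (Excl k l) (Excl l k)             ≡⟨ cong (Fg *_) (coprime⇒gcd≡1 (C1⇒Excl-coprime C1c k l)) ⟩
      Fg * 1                                     ≡⟨ *-identityʳ Fg ⟩
      Fg                                         ∎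
    where
    open ≡-Reasoning
    Fg = ProdPrimary c (gcd k l)

  -- Conversely, if F is GCD-morphic then the exclusive parts are coprime,
  -- cancelling the nonzero common factor F_{gcd k l}.
  GCDMorphic⇒Excl-coprime : Positive c → GCDMorphic (ProdPrimary c) →
                            ∀ k l → k ≥ 1 → l ≥ 1 → gcd (Excl k l) (Excl l k) ≡ 1
  GCDMorphic⇒Excl-coprime pos morphic k l k≥1 l≥1 =
    *-cancelˡ-≡ _ 1 Fg {{ProdPrimary-nonZero pos (gcd k l)}} (begin
      Fg * gcd (Excl k l) (Excl l k)             ≡⟨ gcd-ProdPrimary k l k≥1 l≥1 ⟨
      gcd (ProdPrimary c k) (ProdPrimary c l)    ≡⟨ morphic k l k≥1 l≥1 ⟩
      Fg                                         ≡⟨ *-identityʳ Fg ⟨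
      Fg * 1                                     ∎)
    where
    open ≡-Reasoning
    Fg = ProdPrimary c (gcd k l)

  -- c_n is the factor of Excl n k at index n, provided n ∤ k.
  c∣Excl : ∀ {n k} → n ≥ 1 → ¬ n ∣ k → c n ∣ Excl n k
  c∣Excl {n} {k} n≥1 n∤k = subst (_∣ Excl n k) (pick-true (c n) (divOnly-complete ∣-refl n∤k))
    (∣-prod1 (λ i → pick (divOnly i n k) (c i)) n n≥1 ≤-refl)

  GCDMorphic⇒C1 : Positive c → GCDMorphic (ProdPrimary c) → C1 c
  GCDMorphic⇒C1 pos morphic k n k≥1 n≥1 k<n gcd≢k = ∣1⇒≡1
    (subst (gcd (c n) (c k) ∣_) (GCDMorphic⇒Excl-coprime pos morphic n k n≥1 k≥1)
      (gcd-greatest (∣-trans (gcd[m,n]∣m (c n) (c k)) (c∣Excl n≥1 n∤k))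
                    (∣-trans (gcd[m,n]∣n (c n) (c k)) (c∣Excl k≥1 k∤n))))
    where
    n∤k : ¬ n ∣ k
    n∤k = >⇒∤ {{>-nonZero k≥1}} k<n
    k∤n : ¬ k ∣ n
    k∤n k∣n = gcd≢k (k∣n⇒gcd≡k k∣n)

lemma2 : (c : ℕ → ℕ) → Positive c →
         (GCDMorphic (ProdPrimary c) → C1 c) × (C1 c → GCDMorphic (ProdPrimary c))
lemma2 c pos = GCDMorphic⇒C1 c pos , C1⇒GCDMorphic c
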